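{- Let $p$ be a prime. For a positive divisor $d$ of $p-1$, let $F_d(p)$ denote the number of integers $x$ with $1 \leq x \leq p-1$, $\operatorname{ord}_p x = d$, and $x^x \equiv x \pmod{p}$. Then: (1) if $3 \mid (p-1)$, then $F_3(p) = 0$ or $F_3(p) = 1$; (2) if $4 \mid (p-1)$, then $F_4(p) = 0$ or $F_4(p) = 1$; (3) if $6 \mid (p-1)$, then $F_6(p) = 0$ or $F_6(p) = 2$.
   Context: $\operatorname{ord}_p x$ denotes the multiplicative order of $x$ modulo $p$. -}

module Defs where

open import Data.Nat using (ℕ; zero; suc; _+_; _*_; _∸_; _^_; _≡ᵇ_; NonZero)
open import Data.Nat.DivMod using (_%_)
open import Data.Bool using (Bool; true; false; _∧_; not)
open import Data.List using (List; length; filterᵇ; map; upTo)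
open import Data.Bool.ListAction using (all)

_≡[mod_]ᵇ_ : ℕ → (p : ℕ) → .{{NonZero p}} → ℕ → Bool
(x ≡[mod p ]ᵇ y) = (x % p) ≡ᵇ (y % p)

oneTo : ℕ → List ℕ
oneTo n = map suc (upTo n)

isOrdᵇ : (p : ℕ) → .{{NonZero p}} → ℕ → ℕ → Bool
isOrdᵇ p x zero = false
isOrdᵇ p x (suc d) =
  ((x ^ suc d) ≡[mod p ]ᵇ 1) ∧ all (λ k → not ((x ^ k) ≡[mod p ]ᵇ 1)) (oneTo d)

F : (p : ℕ) → .{{NonZero p}} → ℕ → ℕ
F p d = length (filterᵇ (λ x → isOrdᵇ p x d ∧ ((x ^ x) ≡[mod p ]ᵇ x)) (oneTo (p ∸ 1)))

module Submission where

-- For 1 ≤ x < p,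
-- x^x ≡ x holds iff x^(x-1) ≡ 1, i.e. iff ord x divides x - 1 (the self-power
-- criterion).  Elements of order 3, 4, 6 are roots of Φ b X = X² + bX + 1 for
-- b = 1, 0, -1, and two distinct roots x, y satisfy x + y ≡ -b (Vieta); for
-- residues in (0, p) this pins down x + y = p - 1, p, p + 1 respectively.
--   * Orders 3, 4: if moreover x ≡ y ≡ 1 (mod d) and d ∣ p - 1, then
--     x + y = p - 1 resp. p gives 3 ∣ 2 resp. 4 ∣ 1; so F ≤ 1.
--   * Order 6: two solutions are equal or sum to p + 1, and p + 1 - x is the
--     inverse of x, hence a solution different from x; so F ∈ {0, 2}.

open import Defs
open import Data.Nat using (ℕ; _∸_; NonZero)
open import Data.Nat.Divisibility using (_∣_)
open import Data.Nat.Primality using (Prime)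
open import Data.Product using (_×_)
open import Data.Sum using (_⊎_)
open import Relation.Binary.PropositionalEquality using (_≡_)

open import Data.Nat as ℕ using (zero; suc; _<_; _≤_; z≤n; s≤s; _≟_; _<?_)
import Data.Nat.Properties as ℕᵖ
open import Data.Nat.Divisibility
  using (divides; ∣m+n∣m⇒∣n; ∣m∣n⇒∣m+n; >⇒∤; m%n≡0⇒n∣m)
open import Data.Nat.DivMod using (_%_; _/_; m≡m%n+[m/n]*n; m%n<n)
open import Data.Nat.Primality using (euclidsLemma)
import Data.Nat.Tactic.RingSolver as ℕSolver
open import Data.Integer using (ℤ; +_; _+_; _*_; _-_; -_; _^_; 0ℤ; 1ℤ; ∣_∣)
import Data.Integer.Properties as ℤᵖ
open import Data.Integer.Divisibility.Signed
  using (∣ᵤ⇒∣; ∣⇒∣ᵤ; ∣m∣n⇒∣m-n; ∣m⇒∣-m; ∣m⇒∣m*n; ∣n⇒∣m*n; ∣-refl)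
  renaming (_∣_ to _∣ᶻ_; divides to dividesᶻ)
open import Data.Integer.Tactic.RingSolver using (solve-∀)
open import Data.Bool using (Bool; true; false; T; not; _∧_)
open import Data.Bool.Properties using (T-∧)
open import Data.Bool.ListAction using (all)
open import Data.List using (List; []; _∷_; length; map; upTo; filterᵇ)
open import Data.List.Membership.Propositional using (_∈_)
open import Data.List.Membership.Propositional.Properties
  using (∈-filter⁻; ∈-filter⁺; ∈-map⁻; ∈-map⁺; ∈-upTo⁻; ∈-upTo⁺)
open import Data.List.Relation.Unary.Any using (here; there)
open import Data.List.Relation.Unary.All as All using (All; []; _∷_)
open import Data.List.Relation.Unary.AllPairs using (_∷_)
open import Data.List.Relation.Unary.Unique.Propositional using (Unique)
import Data.List.Relation.Unary.Unique.Propositional.Properties as Uniqueᵖ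
open import Data.Product using (_,_; ∃-syntax; proj₁; proj₂)
import Data.Sum as Sum
open import Data.Sum using (inj₁; inj₂; [_,_]′)
open import Data.Empty using (⊥-elim)
open import Function using (_∘_; id; _⇔_; mk⇔; Equivalence; case_of_)
open import Relation.Nullary using (¬_; yes; no)
open import Relation.Nullary.Decidable using (T?; True; toWitness)
open import Relation.Binary using (Setoid)
open import Level using (0ℓ)
import Relation.Binary.Reasoning.Setoid as SetoidReasoning
open import Relation.Binary.PropositionalEquality
  using (refl; sym; trans; cong; subst; _≢_; module ≡-Reasoning)

open Equivalence using (to; from)

length-0-or-1 : ∀ {A : Set} {ys : List A} → Unique ys →
                (∀ {a b} → a ∈ ys → b ∈ ys → a ≡ b) →
                length ys ≡ 0 ⊎ length ys ≡ 1
length-0-or-1 {ys = []}    _ _ = inj₁ refl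
length-0-or-1 {ys = _ ∷ []} _ _ = inj₂ refl
length-0-or-1 {ys = _ ∷ _ ∷ _} ((a≢b ∷ _) ∷ _) same =
  ⊥-elim (a≢b (same (here refl) (there (here refl))))

-- If any two members of a duplicate-free list are equal or sum to c, and every
-- member has a different partner in the list, the list has 0 or 2 elements:
-- a partner forces two elements, and a third one d would give a + b = c = a + d.
length-0-or-2 : ∀ {ys : List ℕ} (c : ℕ) → Unique ys →
                (∀ {a b} → a ∈ ys → b ∈ ys → a ≡ b ⊎ a ℕ.+ b ≡ c) →
                (∀ {a} → a ∈ ys → ∃[ b ] b ∈ ys × b ≢ a) →
                length ys ≡ 0 ⊎ length ys ≡ 2
length-0-or-2 {[]} _ _ _ _ = inj₁ refl
length-0-or-2 {_ ∷ []} _ _ _ partner with partner (here refl)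
... | _ , here refl , b≢a = ⊥-elim (b≢a refl)
length-0-or-2 {_ ∷ _ ∷ []} _ _ _ _ = inj₂ refl
length-0-or-2 {a ∷ b ∷ d ∷ _} c ((a≢b ∷ a≢d ∷ _) ∷ (b≢d ∷ _) ∷ _) paired _
  with paired (here refl) (there (here refl))
     | paired (here refl) (there (there (here refl)))
... | inj₁ a≡b | _ = ⊥-elim (a≢b a≡b)
... | _ | inj₁ a≡d = ⊥-elim (a≢d a≡d)
... | inj₂ a+b≡c | inj₂ a+d≡c =
  ⊥-elim (b≢d (ℕᵖ.+-cancelˡ-≡ a b d (trans a+b≡c (sym a+d≡c))))

∈-oneTo⁻ : ∀ {n a} → a ∈ oneTo n → ∃[ i ] a ≡ suc i × i < n
∈-oneTo⁻ a∈ with ∈-map⁻ suc a∈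
... | i , i∈ , a≡1+i = i , a≡1+i , ∈-upTo⁻ i∈

∈-oneTo⁺ : ∀ {n i} → i < n → suc i ∈ oneTo n
∈-oneTo⁺ i<n = ∈-map⁺ suc (∈-upTo⁺ i<n)

oneTo-unique : ∀ n → Unique (oneTo n)
oneTo-unique n = Uniqueᵖ.map⁺ ℕᵖ.suc-injective (Uniqueᵖ.upTo⁺ n)

T-all : ∀ {A : Set} (f : A → Bool) (xs : List A) → T (all f xs) ⇔ All (T ∘ f) xs
T-all f [] = mk⇔ (λ _ → []) (λ _ → _)
T-all f (x ∷ xs) = mk⇔
  (λ t → let (fx , rest) = to T-∧ t in fx ∷ to (T-all f xs) rest)
  (λ { (fx ∷ rest) → from T-∧ (fx , from (T-all f xs) rest) })

T-not : ∀ {b} → T (not b) ⇔ (¬ T b)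
T-not {false} = mk⇔ (λ _ ()) (λ _ → _)
T-not {true}  = mk⇔ (λ ()) (λ ¬t → ¬t _)

multiple-between-0-and-2p : ∀ {p n} → p ∣ n → 0 < n → n < p ℕ.+ p → n ≡ p
multiple-between-0-and-2p (divides zero refl) () _
multiple-between-0-and-2p {p} (divides 1 refl) _ _ = ℕᵖ.+-identityʳ p
multiple-between-0-and-2p {p} (divides (suc (suc k)) refl) _ n<2p =
  ⊥-elim (ℕᵖ.<⇒≱ n<2p (ℕᵖ.+-monoʳ-≤ p (ℕᵖ.m≤m+n p (k ℕ.* p))))

multiple-below : ∀ {p n} → p ∣ n → n < p → n ≡ 0
multiple-below {n = zero}  _   _   = refl
multiple-below {n = suc _} p∣n n<p = ⊥-elim (>⇒∤ n<p p∣n)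

divides-remainder : ∀ {d i j r} → d ∣ i → d ∣ j → d ∣ i ℕ.+ j ℕ.+ r → d ∣ r
divides-remainder d∣i d∣j d∣sum = ∣m+n∣m⇒∣n d∣sum (∣m∣n⇒∣m+n d∣i d∣j)

pos-^ : ∀ x n → + (x ℕ.^ n) ≡ (+ x) ^ n
pos-^ x zero    = refl
pos-^ x (suc n) = trans (ℤᵖ.pos-* x (x ℕ.^ n)) (cong (_*_ (+ x)) (pos-^ x n))

-- The quadratics X² + bX + 1; b = 1, 0, -1 give the cyclotomic polynomials
-- whose roots are the elements of order 3, 4, 6.
Φ : ℤ → ℤ → ℤ
Φ b x = x * x + b * x + 1ℤ

cube-minus-one : ∀ x → x ^ 3 - 1ℤ ≡ (x ^ 1 - 1ℤ) * Φ 1ℤ x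
cube-minus-one = unfolded
  where
  unfolded : ∀ x → x * (x * (x * 1ℤ)) - 1ℤ ≡ (x * 1ℤ - 1ℤ) * (x * x + 1ℤ * x + 1ℤ)
  unfolded = solve-∀

fourth-minus-one : ∀ x → x ^ 4 - 1ℤ ≡ (x ^ 2 - 1ℤ) * Φ 0ℤ x
fourth-minus-one = unfolded
  where
  unfolded : ∀ x → x * (x * (x * (x * 1ℤ))) - 1ℤ
                 ≡ (x * (x * 1ℤ) - 1ℤ) * (x * x + 0ℤ * x + 1ℤ)
  unfolded = solve-∀

sixth-minus-one : ∀ x → x ^ 6 - 1ℤ ≡ (x ^ 2 - 1ℤ) * (Φ 1ℤ x * Φ (- 1ℤ) x)
sixth-minus-one = unfolded
  where
  unfolded : ∀ x → x * (x * (x * (x * (x * (x * 1ℤ))))) - 1ℤ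
                 ≡ (x * (x * 1ℤ) - 1ℤ)
                   * ((x * x + 1ℤ * x + 1ℤ) * (x * x + (- 1ℤ) * x + 1ℤ))
  unfolded = solve-∀

Φ-difference : ∀ b x y → Φ b x - Φ b y ≡ (x - y) * (x + y + b)
Φ-difference = unfolded
  where
  unfolded : ∀ b x y → (x * x + b * x + 1ℤ) - (y * y + b * y + 1ℤ) ≡ (x - y) * (x + y + b)
  unfolded = solve-∀

-- A root x of Φ b has inverse -(x + b).
Φ-inverse : ∀ b x → x * - (x + b) - 1ℤ ≡ - Φ b x
Φ-inverse = unfolded
  where
  unfolded : ∀ b x → x * - (x + b) - 1ℤ ≡ - (x * x + b * x + 1ℤ)
  unfolded = solve-∀

module Congruence (p : ℕ) .{{_ : NonZero p}} where

  infix 4 _≈_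

  -- a ≈ b when p divides a - b (a record, so that a and b stay inferable).
  record _≈_ (a b : ℤ) : Set where
    constructor ≈-by
    field difference : + p ∣ᶻ a - b

  ≈-refl : ∀ {a} → a ≈ a
  ≈-refl {a} = ≈-by (subst (+ p ∣ᶻ_) (sym (ℤᵖ.+-inverseʳ a)) (dividesᶻ 0ℤ refl))

  ≈-reflexive : ∀ {a b} → a ≡ b → a ≈ b
  ≈-reflexive refl = ≈-refl

  ≈-sym : ∀ {a b} → a ≈ b → b ≈ a
  ≈-sym {a} {b} (≈-by d) = ≈-by (subst (+ p ∣ᶻ_) (swap a b) (∣m⇒∣-m d))
    where
    swap : ∀ a b → - (a - b) ≡ b - a
    swap = solve-∀

  ≈-trans : ∀ {a b c} → a ≈ b → b ≈ c → a ≈ c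
  ≈-trans {a} {b} {c} (≈-by d) (≈-by e) =
    ≈-by (subst (+ p ∣ᶻ_) (telescope a b c) (∣m∣n⇒∣m-n d (∣m⇒∣-m e)))
    where
    telescope : ∀ a b c → (a - b) - - (b - c) ≡ a - c
    telescope = solve-∀

  ≈-setoid : Setoid 0ℓ 0ℓ
  ≈-setoid = record
    { Carrier = ℤ ; _≈_ = _≈_
    ; isEquivalence = record { refl = ≈-refl ; sym = ≈-sym ; trans = ≈-trans } }

  module ≈-Reasoning = SetoidReasoning ≈-setoid

  *-cong : ∀ {a b c d} → a ≈ b → c ≈ d → a * c ≈ b * d
  *-cong {a} {b} {c} {d} (≈-by a-b) (≈-by c-d) =
    ≈-by (subst (+ p ∣ᶻ_) (split a b c d)
                (∣m∣n⇒∣m-n (∣m⇒∣m*n c a-b) (∣m⇒∣-m (∣n⇒∣m*n b c-d))))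
    where
    split : ∀ a b c d → (a - b) * c - - (b * (c - d)) ≡ a * c - b * d
    split = solve-∀

  ^-cong : ∀ {a b} → a ≈ b → ∀ n → a ^ n ≈ b ^ n
  ^-cong a≈b zero    = ≈-refl
  ^-cong a≈b (suc n) = *-cong a≈b (^-cong a≈b n)

  complement : ∀ {m n} → m ℕ.+ n ≡ p → + n ≈ - (+ m)
  complement {m} {n} m+n≡p = ≈-by (subst (+ p ∣ᶻ_) p≡n+m ∣-refl)
    where
    open ≡-Reasoning
    p≡n+m : + p ≡ + n - - (+ m)
    p≡n+m = begin
      + p              ≡⟨ cong +_ (trans (sym m+n≡p) (ℕᵖ.+-comm m n)) ⟩
      + (n ℕ.+ m)      ≡⟨ ℤᵖ.pos-+ n m ⟩
      + n + + m        ≡⟨ cong (λ t → + n + t) (sym (ℤᵖ.neg-involutive (+ m))) ⟩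
      + n - - (+ m)    ∎

  ≈-% : ∀ x → + x ≈ + (x % p)
  ≈-% x = ≈-by (dividesᶻ (+ (x / p)) x-r≡qp)
    where
    open ≡-Reasoning
    r q : ℕ
    r = x % p
    q = x / p
    cancel : ∀ r s → (r + s) - r ≡ s
    cancel = solve-∀
    x-r≡qp : + x - + r ≡ + q * + p
    x-r≡qp = begin
      + x - + r                  ≡⟨ cong (λ t → + t - + r) (m≡m%n+[m/n]*n x p) ⟩
      + (r ℕ.+ q ℕ.* p) - + r    ≡⟨ cong (_- + r) (ℤᵖ.pos-+ r (q ℕ.* p)) ⟩
      (+ r + + (q ℕ.* p)) - + r  ≡⟨ cancel (+ r) (+ (q ℕ.* p)) ⟩
      + (q ℕ.* p)                ≡⟨ ℤᵖ.pos-* q p ⟩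
      + q * + p                  ∎

  -- Congruent residues r ≤ s < p are equal, since p ∣ s - r < p.
  residue-unique-≤ : ∀ {r s} → r ≤ s → s < p → + r ≈ + s → r ≡ s
  residue-unique-≤ {r} {s} r≤s s<p (≈-by p∣r-s) =
    ℕᵖ.≤-antisym r≤s (ℕᵖ.m∸n≡0⇒m≤n s-r≡0)
    where
    ∣r-s∣≡s-r : ∣ + r - + s ∣ ≡ s ∸ r
    ∣r-s∣≡s-r = trans (cong ∣_∣ (ℤᵖ.[+m]-[+n]≡m⊖n r s)) (ℤᵖ.∣⊖∣-≤ r≤s)
    p∣s-r : p ∣ s ∸ r
    p∣s-r = subst (p ∣_) ∣r-s∣≡s-r (∣⇒∣ᵤ p∣r-s)
    s-r≡0 : s ∸ r ≡ 0
    s-r≡0 = multiple-below p∣s-r (ℕᵖ.≤-<-trans (ℕᵖ.m∸n≤m s r) s<p)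

  residue-unique : ∀ {r s} → r < p → s < p → + r ≈ + s → r ≡ s
  residue-unique {r} {s} r<p s<p r≈s with ℕᵖ.≤-total r s
  ... | inj₁ r≤s = residue-unique-≤ r≤s s<p r≈s
  ... | inj₂ s≤r = sym (residue-unique-≤ s≤r r<p (≈-sym r≈s))

  power-test : ∀ x k y → T ((x ℕ.^ k) ≡[mod p ]ᵇ y) ⇔ (+ x) ^ k ≈ + y
  power-test x k y = mk⇔
    (λ t → subst (_≈ + y) (pos-^ x k) (via-remainders (ℕᵖ.≡ᵇ⇒≡ _ _ t)))
    (λ x^k≈y → ℕᵖ.≡⇒≡ᵇ _ _ (remainders (subst (_≈ + y) (sym (pos-^ x k)) x^k≈y)))
    where
    via-remainders : ∀ {a b} → a % p ≡ b % p → + a ≈ + b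
    via-remainders {a} {b} eq =
      ≈-trans (≈-% a) (≈-trans (≈-reflexive (cong +_ eq)) (≈-sym (≈-% b)))
    remainders : ∀ {a b} → + a ≈ + b → a % p ≡ b % p
    remainders {a} {b} a≈b = residue-unique (m%n<n a p) (m%n<n b p)
      (≈-trans (≈-sym (≈-% a)) (≈-trans a≈b (≈-% b)))

  record HasOrder (a : ℤ) (d : ℕ) : Set where
    field
      power-one : a ^ d ≈ 1ℤ
      minimal   : ∀ k → 0 < k → k < d → ¬ (a ^ k ≈ 1ℤ)
  open HasOrder public

  -- For numerals 0 < k < d the bounds on k are checked by evaluation.
  below-order : ∀ {a d} → HasOrder a d →
                ∀ k .{{_ : NonZero k}} {k<d : True (k <? d)} → ¬ (a ^ k ≈ 1ℤ)
  below-order o k {k<d} = minimal o k (ℕ.>-nonZero⁻¹ k) (toWitness k<d)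

  isOrdᵇ⇔HasOrder : ∀ x d → T (isOrdᵇ p x (suc d)) ⇔ HasOrder (+ x) (suc d)
  isOrdᵇ⇔HasOrder x d = mk⇔ decode encode
    where
    notOne : ℕ → Bool
    notOne k = not ((x ℕ.^ k) ≡[mod p ]ᵇ 1)

    decode : T (isOrdᵇ p x (suc d)) → HasOrder (+ x) (suc d)
    decode t = record { power-one = to (power-test x (suc d) 1) x^d≡1 ; minimal = minimal′ }
      where
      x^d≡1 : T ((x ℕ.^ suc d) ≡[mod p ]ᵇ 1)
      x^d≡1 = proj₁ (to T-∧ t)
      below : All (T ∘ notOne) (oneTo d)
      below = to (T-all notOne (oneTo d)) (proj₂ (to T-∧ t))
      minimal′ : ∀ k → 0 < k → k < suc d → ¬ ((+ x) ^ k ≈ 1ℤ)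
      minimal′ (suc k) _ (s≤s k<d) x^k≈1 =
        to T-not (All.lookup below (∈-oneTo⁺ k<d)) (from (power-test x (suc k) 1) x^k≈1)

    encode : HasOrder (+ x) (suc d) → T (isOrdᵇ p x (suc d))
    encode o = from T-∧ ( from (power-test x (suc d) 1) (power-one o)
                        , from (T-all notOne (oneTo d)) below)
      where
      below : All (T ∘ notOne) (oneTo d)
      below = All.tabulate λ k∈ → case ∈-oneTo⁻ k∈ of λ where
        (k , refl , k<d) → from T-not λ t →
          minimal o (suc k) (s≤s z≤n) (s≤s k<d) (to (power-test x (suc k) 1) t)

  power-mod-order : ∀ {a d} → a ^ d ≈ 1ℤ → ∀ r q → a ^ (r ℕ.+ d ℕ.* q) ≈ a ^ r
  power-mod-order {a} {d} a^d≈1 r q = begin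
    a ^ (r ℕ.+ d ℕ.* q)      ≡⟨ ℤᵖ.^-distribˡ-+-* a r (d ℕ.* q) ⟩
    a ^ r * a ^ (d ℕ.* q)    ≡⟨ cong (a ^ r *_) (sym (ℤᵖ.^-*-assoc a d q)) ⟩
    a ^ r * (a ^ d) ^ q      ≈⟨ *-cong (≈-refl {a ^ r}) (^-cong a^d≈1 q) ⟩
    a ^ r * 1ℤ ^ q           ≡⟨ cong (a ^ r *_) (ℤᵖ.^-zeroˡ q) ⟩
    a ^ r * 1ℤ               ≡⟨ ℤᵖ.*-identityʳ (a ^ r) ⟩
    a ^ r                    ∎
    where open ≈-Reasoning

  power-of-inverses : ∀ {a b} → a * b ≈ 1ℤ → ∀ k → a ^ k * b ^ k ≈ 1ℤ
  power-of-inverses ab≈1 zero = ≈-refl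
  power-of-inverses {a} {b} ab≈1 (suc k) = begin
    (a * a ^ k) * (b * b ^ k)  ≡⟨ regroup a b (a ^ k) (b ^ k) ⟩
    (a * b) * (a ^ k * b ^ k)  ≈⟨ *-cong ab≈1 (power-of-inverses ab≈1 k) ⟩
    1ℤ * 1ℤ                    ≡⟨⟩
    1ℤ                         ∎
    where
    open ≈-Reasoning
    regroup : ∀ a b x y → (a * x) * (b * y) ≡ (a * b) * (x * y)
    regroup = solve-∀

  other-factor-one : ∀ {a b} → a * b ≈ 1ℤ → b ≈ 1ℤ → a ≈ 1ℤ
  other-factor-one {a} {b} ab≈1 b≈1 = begin
    a        ≡⟨ sym (ℤᵖ.*-identityʳ a) ⟩
    a * 1ℤ   ≈⟨ *-cong (≈-refl {a}) (≈-sym b≈1) ⟩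
    a * b    ≈⟨ ab≈1 ⟩
    1ℤ       ∎
    where open ≈-Reasoning

  order-of-inverse : ∀ {a b d} → a * b ≈ 1ℤ → HasOrder a d → HasOrder b d
  order-of-inverse {a} {b} {d} ab≈1 o = record
    { power-one = other-factor-one (powers-ba d) (power-one o)
    ; minimal   = λ k 0<k k<d b^k≈1 →
        minimal o k 0<k k<d (other-factor-one (power-of-inverses ab≈1 k) b^k≈1)
    }
    where
    powers-ba : ∀ k → b ^ k * a ^ k ≈ 1ℤ
    powers-ba = power-of-inverses (≈-trans (≈-reflexive (ℤᵖ.*-comm b a)) ab≈1)

  self-power⇐ : ∀ {a d i} → a ^ d ≈ 1ℤ → d ∣ i → a ^ suc i ≈ a
  self-power⇐ {a} {d} a^d≈1 (divides q refl) = begin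
    a * a ^ (q ℕ.* d)           ≡⟨ cong (λ e → a * a ^ e) (ℕᵖ.*-comm q d) ⟩
    a * a ^ (0 ℕ.+ d ℕ.* q)     ≈⟨ *-cong (≈-refl {a}) (power-mod-order {a} {d} a^d≈1 0 q) ⟩
    a * 1ℤ                      ≡⟨ ℤᵖ.*-identityʳ a ⟩
    a                           ∎
    where open ≈-Reasoning

module PrimeModulus (p : ℕ) .{{_ : NonZero p}} (p-prime : Prime p) where
  open Congruence p

  euclid : ∀ a b → + p ∣ᶻ a * b → + p ∣ᶻ a ⊎ + p ∣ᶻ b
  euclid a b p∣ab = Sum.map ∣ᵤ⇒∣ ∣ᵤ⇒∣
    (euclidsLemma ∣ a ∣ ∣ b ∣ p-prime (subst (p ∣_) (ℤᵖ.abs-* a b) (∣⇒∣ᵤ p∣ab)))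

  small-unit : ∀ {x} → 0 < x → x < p → ¬ (+ p ∣ᶻ + x)
  small-unit {suc x} _ x<p p∣x = >⇒∤ x<p (∣⇒∣ᵤ p∣x)

  cancel-unit : ∀ {a b} → ¬ (+ p ∣ᶻ a) → a * b ≈ a → b ≈ 1ℤ
  cancel-unit {a} {b} a-unit (≈-by p∣ab-a) =
    [ ⊥-elim ∘ a-unit , ≈-by ]′ (euclid a (b - 1ℤ) (subst (+ p ∣ᶻ_) (factor a b) p∣ab-a))
    where
    factor : ∀ a b → a * b - a ≡ a * (b - 1ℤ)
    factor = solve-∀

  -- Self-power criterion: a unit a of order d satisfies a^(1+i) ≈ a only if
  -- d ∣ i, since a^(1+i) ≈ a * a^(i mod d) and i mod d < d.
  self-power⇒ : ∀ {a d i} .{{_ : NonZero d}} →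
                ¬ (+ p ∣ᶻ a) → HasOrder a d → a ^ suc i ≈ a → d ∣ i
  self-power⇒ {a} {d} {i} a-unit o a^1+i≈a =
    m%n≡0⇒n∣m i d (remainder-zero r (m%n<n i d) a^r≈1)
    where
    open ≈-Reasoning
    r : ℕ
    r = i % d
    i≡r+dq : i ≡ r ℕ.+ d ℕ.* (i / d)
    i≡r+dq = trans (m≡m%n+[m/n]*n i d) (cong (r ℕ.+_) (ℕᵖ.*-comm (i / d) d))
    a^r+dq≈a^r : ∀ q → a ^ (r ℕ.+ d ℕ.* q) ≈ a ^ r
    a^r+dq≈a^r = power-mod-order {a} {d} (power-one o) r
    a^r≈1 : a ^ r ≈ 1ℤ
    a^r≈1 = cancel-unit a-unit (begin
      a * a ^ r                       ≈⟨ *-cong (≈-refl {a}) (≈-sym (a^r+dq≈a^r (i / d))) ⟩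
      a * a ^ (r ℕ.+ d ℕ.* (i / d))   ≡⟨ cong (λ e → a * a ^ e) (sym i≡r+dq) ⟩
      a ^ suc i                       ≈⟨ a^1+i≈a ⟩
      a                               ∎)
    remainder-zero : ∀ r → r < d → a ^ r ≈ 1ℤ → r ≡ 0
    remainder-zero zero    _   _     = refl
    remainder-zero (suc r) r<d a^r≈1 = ⊥-elim (minimal o (suc r) (s≤s z≤n) r<d a^r≈1)

  root-of-cofactor : ∀ a n {f g} →
                     a ^ n ≈ 1ℤ → a ^ n - 1ℤ ≡ f * g → ¬ (+ p ∣ᶻ f) → + p ∣ᶻ g
  root-of-cofactor _ _ (≈-by p∣aⁿ-1) factorisation p∤f =
    [ ⊥-elim ∘ p∤f , id ]′ (euclid _ _ (subst (+ p ∣ᶻ_) factorisation p∣aⁿ-1))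

  order-3-root : ∀ {a} → HasOrder a 3 → + p ∣ᶻ Φ 1ℤ a
  order-3-root {a} o =
    root-of-cofactor a 3 (power-one o) (cube-minus-one a) (below-order o 1 ∘ ≈-by)

  order-4-root : ∀ {a} → HasOrder a 4 → + p ∣ᶻ Φ 0ℤ a
  order-4-root {a} o =
    root-of-cofactor a 4 (power-one o) (fourth-minus-one a) (below-order o 2 ∘ ≈-by)

  -- For order 6, x⁶ - 1 = (x² - 1) Φ 1 x Φ (-1) x, and a root of Φ 1 would have a³ ≈ 1.
  order-6-root : ∀ {a} → HasOrder a 6 → + p ∣ᶻ Φ (- 1ℤ) a
  order-6-root {a} o = [ ⊥-elim ∘ not-root-of-Φ₁ , id ]′ (euclid _ _ p∣Φ₁Φ₋₁)
    where
    p∣Φ₁Φ₋₁ : + p ∣ᶻ Φ 1ℤ a * Φ (- 1ℤ) a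
    p∣Φ₁Φ₋₁ = root-of-cofactor a 6 (power-one o) (sixth-minus-one a) (below-order o 2 ∘ ≈-by)
    not-root-of-Φ₁ : ¬ (+ p ∣ᶻ Φ 1ℤ a)
    not-root-of-Φ₁ p∣Φ₁ = below-order o 3
      (≈-by (subst (+ p ∣ᶻ_) (sym (cube-minus-one a)) (∣n⇒∣m*n (a ^ 1 - 1ℤ) p∣Φ₁)))

  roots-sum : ∀ {b x y n} → x < p → y < p → x ≢ y →
              + p ∣ᶻ Φ b (+ x) → + p ∣ᶻ Φ b (+ y) →
              + n ≡ + x + + y + b → 0 < n → n < p ℕ.+ p → n ≡ p
  roots-sum {b} {x} {y} {n} x<p y<p x≢y p∣Φx p∣Φy n≡x+y+b 0<n n<2p =
    multiple-between-0-and-2p (∣⇒∣ᵤ p∣n) 0<n n<2p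
    where
    p∣difference : + p ∣ᶻ (+ x - + y) * (+ x + + y + b)
    p∣difference = subst (+ p ∣ᶻ_) (Φ-difference b (+ x) (+ y)) (∣m∣n⇒∣m-n p∣Φx p∣Φy)
    x≉y : ¬ (+ p ∣ᶻ + x - + y)
    x≉y p∣x-y = x≢y (residue-unique x<p y<p (≈-by p∣x-y))
    p∣n : + p ∣ᶻ + n
    p∣n = subst (+ p ∣ᶻ_) (sym n≡x+y+b) ([ ⊥-elim ∘ x≉y , id ]′ (euclid _ _ p∣difference))

  root-inverse : ∀ {b a} → + p ∣ᶻ Φ b a → a * - (a + b) ≈ 1ℤ
  root-inverse {b} {a} p∣Φ = ≈-by (subst (+ p ∣ᶻ_) (sym (Φ-inverse b a)) (∣m⇒∣-m p∣Φ))

module Solutions (p : ℕ) .{{_ : NonZero p}} (p-prime : Prime p) where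
  open Congruence p
  open PrimeModulus p p-prime

  counted : ℕ → ℕ → Bool
  counted d x = isOrdᵇ p x d ∧ ((x ℕ.^ x) ≡[mod p ]ᵇ x)

  solutions : ℕ → List ℕ
  solutions d = filterᵇ (counted d) (oneTo (p ∸ 1))

  range⁺ : ∀ {i} → i < p ∸ 1 → suc i < p
  range⁺ i<p-1 = subst (suc _ <_) (ℕᵖ.suc-pred p) (s≤s i<p-1)

  range⁻ : ∀ {i} → suc i < p → i < p ∸ 1
  range⁻ 1+i<p = ℕᵖ.≤-pred (subst (_ <_) (sym (ℕᵖ.suc-pred p)) 1+i<p)

  solutions-unique : ∀ d → Unique (solutions d)
  solutions-unique d = Uniqueᵖ.filter⁺ (T? ∘ counted d) (oneTo-unique (p ∸ 1))

  -- What it means for 1 + i to be counted by F p d (via the self-power criterion).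
  record Solution (d i : ℕ) : Set where
    field
      in-range  : suc i < p
      order     : HasOrder (+ suc i) d
      divisible : d ∣ i
  open Solution

  ∈-solutions⁻ : ∀ {d a} → a ∈ solutions d → a ∈ oneTo (p ∸ 1) × T (counted d a)
  ∈-solutions⁻ {d} = ∈-filter⁻ (T? ∘ counted d) {xs = oneTo (p ∸ 1)}

  solution⁻ : ∀ d {a} → a ∈ solutions d → ∃[ i ] a ≡ suc i × Solution d i
  solution⁻ zero a∈ with ∈-solutions⁻ {zero} a∈
  ... | _ , ()
  solution⁻ (suc d) a∈ with ∈-solutions⁻ {suc d} a∈
  ... | a∈oneTo , t with ∈-oneTo⁻ a∈oneTo
  ...   | i , refl , i<p-1 = i , refl , record
    { in-range  = range⁺ i<p-1
    ; order     = o
    ; divisible = self-power⇒ (small-unit (s≤s z≤n) (range⁺ i<p-1)) o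
                    (to (power-test (suc i) (suc i) (suc i)) (proj₂ (to T-∧ t)))
    }
    where
    o : HasOrder (+ suc i) (suc d)
    o = to (isOrdᵇ⇔HasOrder (suc i) d) (proj₁ (to T-∧ t))

  solution⁺ : ∀ {d i} → Solution (suc d) i → suc i ∈ solutions (suc d)
  solution⁺ {d} {i} s = ∈-filter⁺ (T? ∘ counted (suc d)) (∈-oneTo⁺ (range⁻ (in-range s)))
    (from T-∧ ( from (isOrdᵇ⇔HasOrder (suc i) d) (order s)
              , from (power-test (suc i) (suc i) (suc i)) self-power))
    where
    self-power : (+ suc i) ^ suc i ≈ + suc i
    self-power = self-power⇐ (power-one (order s)) (divisible s)

  -- If 3 ∣ p - 1, solutions of order 3 are unique: two distinct ones x, y are
  -- roots of Φ 1, so x + y + 1 = p, and x ≡ y ≡ 1 (mod 3) would give 3 ∣ 2.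
  order-3-unique : 3 ∣ p ∸ 1 → ∀ {a b} → a ∈ solutions 3 → b ∈ solutions 3 → a ≡ b
  order-3-unique 3∣p-1 a∈ b∈ with solution⁻ 3 a∈ | solution⁻ 3 b∈
  ... | i , refl , sᵢ | j , refl , sⱼ with suc i ≟ suc j
  ...   | yes same = same
  ...   | no distinct =
    ⊥-elim (>⇒∤ (ℕᵖ.n<1+n 2) (divides-remainder (divisible sᵢ) (divisible sⱼ) 3∣i+j+2))
    where
    x+y+1≡p : suc (suc i ℕ.+ suc j) ≡ p
    x+y+1≡p = roots-sum {b = 1ℤ} (in-range sᵢ) (in-range sⱼ) distinct
      (order-3-root (order sᵢ)) (order-3-root (order sⱼ))
      (trans (cong (_+_ 1ℤ) (ℤᵖ.pos-+ (suc i) (suc j))) (ℤᵖ.+-comm 1ℤ (+ suc i + + suc j)))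
      (s≤s z≤n)
      (subst (_≤ p ℕ.+ p) (cong suc (ℕᵖ.+-suc (suc i) (suc j)))
             (ℕᵖ.+-mono-≤ (in-range sᵢ) (in-range sⱼ)))
    two-more : ∀ i j → suc i ℕ.+ suc j ≡ i ℕ.+ j ℕ.+ 2
    two-more = ℕSolver.solve-∀
    3∣i+j+2 : 3 ∣ i ℕ.+ j ℕ.+ 2
    3∣i+j+2 = subst (3 ∣_) (trans (cong (_∸ 1) (sym x+y+1≡p)) (two-more i j)) 3∣p-1

  -- If 4 ∣ p - 1, solutions of order 4 are unique: distinct ones are roots of
  -- Φ 0, so x + y = p, and x ≡ y ≡ 1 (mod 4) would give 4 ∣ 1.
  order-4-unique : 4 ∣ p ∸ 1 → ∀ {a b} → a ∈ solutions 4 → b ∈ solutions 4 → a ≡ b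
  order-4-unique 4∣p-1 a∈ b∈ with solution⁻ 4 a∈ | solution⁻ 4 b∈
  ... | i , refl , sᵢ | j , refl , sⱼ with suc i ≟ suc j
  ...   | yes same = same
  ...   | no distinct =
    ⊥-elim (>⇒∤ (s≤s (s≤s z≤n)) (divides-remainder (divisible sᵢ) (divisible sⱼ) 4∣i+j+1))
    where
    x+y≡p : suc i ℕ.+ suc j ≡ p
    x+y≡p = roots-sum {b = 0ℤ} (in-range sᵢ) (in-range sⱼ) distinct
      (order-4-root (order sᵢ)) (order-4-root (order sⱼ))
      (trans (ℤᵖ.pos-+ (suc i) (suc j)) (sym (ℤᵖ.+-identityʳ _)))
      (s≤s z≤n)
      (ℕᵖ.+-mono-< (in-range sᵢ) (in-range sⱼ))
    one-more : ∀ i j → i ℕ.+ suc j ≡ i ℕ.+ j ℕ.+ 1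
    one-more = ℕSolver.solve-∀
    4∣i+j+1 : 4 ∣ i ℕ.+ j ℕ.+ 1
    4∣i+j+1 = subst (4 ∣_) (trans (cong (_∸ 1) (sym x+y≡p)) (one-more i j)) 4∣p-1

  -- Distinct solutions of order 6 are roots of Φ (-1), so they sum to p + 1.
  order-6-paired : ∀ {a b} → a ∈ solutions 6 → b ∈ solutions 6 → a ≡ b ⊎ a ℕ.+ b ≡ suc p
  order-6-paired a∈ b∈ with solution⁻ 6 a∈ | solution⁻ 6 b∈
  ... | i , refl , sᵢ | j , refl , sⱼ with suc i ≟ suc j
  ...   | yes same = inj₁ same
  ...   | no distinct = inj₂ (cong suc (roots-sum {b = - 1ℤ} (in-range sᵢ) (in-range sⱼ) distinct
      (order-6-root (order sᵢ)) (order-6-root (order sⱼ))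
      (trans (ℤᵖ.pos-+ i (suc j)) (shift (+ i) (+ suc j)))
      (ℕᵖ.<-≤-trans (s≤s z≤n) (ℕᵖ.m≤n+m (suc j) i))
      (ℕᵖ.+-mono-< (ℕᵖ.<-trans (ℕᵖ.n<1+n i) (in-range sᵢ)) (in-range sⱼ))))
    where
    shift : ∀ a b → a + b ≡ (1ℤ + a) + b + - 1ℤ
    shift = solve-∀

  -- If 6 ∣ p - 1, a solution x of order 6 has a distinct partner p + 1 - x:
  -- it is the inverse of x (so has order 6), is ≡ 1 (mod 6), and equals x
  -- only if x² ≈ 1.
  order-6-partner : 6 ∣ p ∸ 1 → ∀ {a} → a ∈ solutions 6 → ∃[ b ] b ∈ solutions 6 × b ≢ a
  order-6-partner 6∣p-1 a∈ with solution⁻ 6 a∈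
  ... | zero , refl , s = ⊥-elim (below-order (order s) 1 ≈-refl)
  ... | suc i , refl , s = suc j , solution⁺ partner , partner≢x
    where
    x j : ℕ
    x = suc (suc i)
    j = p ∸ 1 ∸ suc i
    1+i≤p-1 : suc i ≤ p ∸ 1
    1+i≤p-1 = ℕᵖ.<⇒≤ (range⁻ (in-range s))
    1+i+1+j≡p : suc i ℕ.+ suc j ≡ p
    1+i+1+j≡p = begin
      suc i ℕ.+ suc j        ≡⟨ ℕᵖ.+-suc (suc i) j ⟩
      suc (suc i ℕ.+ j)      ≡⟨ cong suc (ℕᵖ.m+[n∸m]≡n 1+i≤p-1) ⟩
      suc (p ∸ 1)            ≡⟨ ℕᵖ.suc-pred p ⟩
      p                      ∎
      where open ≡-Reasoning
    shift : ∀ a → (1ℤ + a) + - 1ℤ ≡ a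
    shift = solve-∀
    inverse : + x * + suc j ≈ 1ℤ
    inverse = begin
      + x * + suc j                  ≈⟨ *-cong (≈-refl {+ x}) (complement 1+i+1+j≡p) ⟩
      + x * - (+ suc i)              ≡⟨ cong (λ t → + x * - t) (sym (shift (+ suc i))) ⟩
      + x * - (+ x + - 1ℤ)           ≈⟨ root-inverse {b = - 1ℤ} {a = + x} (order-6-root (order s)) ⟩
      1ℤ                             ∎
      where open ≈-Reasoning
    partner : Solution 6 j
    partner = record
      { in-range  = range⁺ (ℕᵖ.∸-monoʳ-< {o = 0} (s≤s z≤n) 1+i≤p-1)
      ; order     = order-of-inverse inverse (order s)
      ; divisible = ∣m+n∣m⇒∣n (subst (6 ∣_) (sym (ℕᵖ.m+[n∸m]≡n 1+i≤p-1)) 6∣p-1) (divisible s)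
      }
    partner≢x : suc j ≢ x
    partner≢x same = below-order (order s) 2 (begin
      + x * (+ x * 1ℤ)     ≡⟨ cong (_*_ (+ x)) (ℤᵖ.*-identityʳ (+ x)) ⟩
      + x * + x            ≡⟨ cong (λ y → + x * + y) (sym same) ⟩
      + x * + suc j        ≈⟨ inverse ⟩
      1ℤ                   ∎)
      where open ≈-Reasoning

  F₃ : 3 ∣ p ∸ 1 → F p 3 ≡ 0 ⊎ F p 3 ≡ 1
  F₃ 3∣p-1 = length-0-or-1 (solutions-unique 3) (order-3-unique 3∣p-1)

  F₄ : 4 ∣ p ∸ 1 → F p 4 ≡ 0 ⊎ F p 4 ≡ 1
  F₄ 4∣p-1 = length-0-or-1 (solutions-unique 4) (order-4-unique 4∣p-1)

  F₆ : 6 ∣ p ∸ 1 → F p 6 ≡ 0 ⊎ F p 6 ≡ 2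
  F₆ 6∣p-1 = length-0-or-2 (suc p) (solutions-unique 6) order-6-paired (order-6-partner 6∣p-1)

mainTheorem4 : (p : ℕ) → .{{_ : NonZero p}} → Prime p →
    ((3 ∣ p ∸ 1 → F p 3 ≡ 0 ⊎ F p 3 ≡ 1)
    × (4 ∣ p ∸ 1 → F p 4 ≡ 0 ⊎ F p 4 ≡ 1)
    × (6 ∣ p ∸ 1 → F p 6 ≡ 0 ⊎ F p 6 ≡ 2))
mainTheorem4 p p-prime = F₃ , F₄ , F₆
  where open Solutions p p-prime
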